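{- Let $M$ be an accordion with partition $(G,F,H)$ where $F$ is a maximal fan having even length at least four, and $G$ is a left-hand triangle-type end of $F$. Suppose that $F$ has ordering $(e_1,e_2,\ldots,e_{|F|})$, where $\{e_1,e_2,e_3\}$ is a triangle. Then $\sqcap(G, H) = \sqcap^*(G, H) = 1$.
   Context: $M$ is a $3$-connected matroid with rank function $r$ and dual rank function $r^*$. The local connectivity of $X,Y\subseteq E(M)$ is $\sqcap(X,Y)=r(X)+r(Y)-r(X\cup Y)$, and $\sqcap^*(X,Y)=r^*(X)+r^*(Y)-r^*(X\cup Y)$ is the local connectivity in the dual $M^*$. A triangle is a $3$-element circuit, a triad a $3$-element cocircuit, and a quad a $4$-element set that is both a circuit and a cocircuit. A fan is a set $F$ with $|F|\ge 3$ and an ordering $(e_1,\dots,e_{|F|})$ such that $\{e_1,e_2,e_3\}$ is a triangle or triad and, for each $i$, if $\{e_i,e_{i+1},e_{i+2}\}$ is a triangle then $\{e_{i+1},e_{i+2},e_{i+3}\}$ is a triad and vice versa (also any $2$-element set is a fan); a fan is maximal if it is not properly contained in another fan. Let $F=(e_1,\dots,e_{|F|})$ be a maximal fan of $M$ of even length at least four with $\{e_1,e_2,e_3\}$ a triangle, and let $X\subseteq E(M)-F$ with $|E(M)|\ge |X\cup F|+2$. $X$ is a left-hand fan-type end of $F$ if $X\cup\{e_1\}$ is a maximal fan of length five with ordering $(e_1,g_2,g_3,g_4,g_5)$ such that $\{e_1,g_2,g_3\}$ is a triangle and $\{e_1,e_2,g_3,g_5\}$ is a cocircuit. $X$ is a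 left-hand quad-type end if $X=\{a_1,a_2,b_1,b_2\}$ is a quad such that $\{e_1,a_1,a_2\}$ and $\{e_1,b_1,b_2\}$ are triangles, each not contained in a $4$-element fan, and $\{e_1,e_2,a_1,b_1\}$, $\{e_1,e_2,a_2,b_2\}$ are cocircuits. $X$ is a left-hand triangle-type end if $X\cup\{e_1\}$ is a triangle not contained in a $4$-element fan and $X\cup\{e_1,e_2\}$ is a cocircuit. $X$ is a right-hand fan-type end of $F$ if $X\cup\{e_{|F|}\}$ is a maximal fan of length five with ordering $(e_{|F|},h_2,h_3,h_4,h_5)$ such that $\{e_{|F|},h_2,h_3\}$ is a triad and $\{e_{|F|-1},e_{|F|},h_3,h_5\}$ is a circuit. $X$ is a right-hand quad-type end if $X=\{c_1,c_2,d_1,d_2\}$ is a quad such that $\{e_{|F|},c_1,c_2\}$ and $\{e_{|F|},d_1,d_2\}$ are triads, each not contained in a $4$-element fan, and $\{e_{|F|-1},e_{|F|},c_1,d_1\}$, $\{e_{|F|-1},e_{|F|},c_2,d_2\}$ are circuits. $X$ is a right-hand triad-type end if $X\cup\{e_{|F|}\}$ is a triad not contained in a $4$-element fan and $X\cup\{e_{|F|-1},e_{|F|}\}$ is a circuit. $M$ is an accordion with partition $(G,F,H)$ if $(G,F,H)$ partitions $E(M)$, $F$ is a maximal fan of even length at least four, $G$ is a left-hand fan-type, quad-type, or triangle-type end of $F$, and $H$ is a right-hand fan-type, quad-type, or triad-type end of $F$. -}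

module Defs where

open import Data.Nat using (ℕ; _+_; _∸_; _≤_; _<_)
open import Data.Nat.Divisibility using (_∣_)
open import Data.Fin using (Fin)
open import Data.Fin.Subset using (Subset; ⁅_⁆; _⊆_; _⊂_; ∁; _∩_; _∪_; ∣_∣)
  renaming (⊥ to ∅; ⊤ to Full)
open import Data.List using (List; []; _∷_; length; _++_)
open import Data.List.Relation.Unary.Unique.Propositional using (Unique)
open import Data.Product using (Σ; ∃; ∃-syntax; _×_)
open import Data.Sum using (_⊎_)
open import Data.Empty using (⊥)
open import Data.Unit using (⊤)
open import Relation.Nullary using (¬_)
open import Relation.Binary.PropositionalEquality using (_≡_)

record Matroid (n : ℕ) : Set where
  field
    r        : Subset n → ℕ
    r-bound  : ∀ X → r X ≤ ∣ X ∣
    r-mono   : ∀ X Y → X ⊆ Y → r X ≤ r Y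
    r-submod : ∀ X Y → r (X ∪ Y) + r (X ∩ Y) ≤ r X + r Y

module _ {n : ℕ} (M : Matroid n) where
  open Matroid M

  -- dual rank  r*(X) = |X| + r(E - X) - r(E)   (never truncated: r(E) ≤ |X| + r(E-X))
  r* : Subset n → ℕ
  r* X = ∣ X ∣ + r (∁ X) ∸ r Full

  -- local connectivity (never truncated, by submodularity)
  ⊓ : Subset n → Subset n → ℕ
  ⊓ X Y = r X + r Y ∸ r (X ∪ Y)

  ⊓* : Subset n → Subset n → ℕ
  ⊓* X Y = r* X + r* Y ∸ r* (X ∪ Y)

  conn : Subset n → ℕ
  conn X = r X + r (∁ X) ∸ r Full

  ThreeConnected : Set
  ThreeConnected = ∀ (k : ℕ) (X : Subset n) → 1 ≤ k → k < 3 →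
    k ≤ ∣ X ∣ → k ≤ ∣ ∁ X ∣ → k ≤ conn X

  DependentWrt : (Subset n → ℕ) → Subset n → Set
  DependentWrt ρ X = ρ X < ∣ X ∣

  CircuitWrt : (Subset n → ℕ) → Subset n → Set
  CircuitWrt ρ C = DependentWrt ρ C × (∀ Y → Y ⊂ C → ¬ DependentWrt ρ Y)

  Circuit : Subset n → Set
  Circuit = CircuitWrt r

  Cocircuit : Subset n → Set
  Cocircuit = CircuitWrt r*

  Triangle : Subset n → Set
  Triangle T = Circuit T × ∣ T ∣ ≡ 3

  Triad : Subset n → Set
  Triad T = Cocircuit T × ∣ T ∣ ≡ 3

  Quad : Subset n → Set
  Quad Q = Circuit Q × Cocircuit Q × ∣ Q ∣ ≡ 4

  toSet : List (Fin n) → Subset n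
  toSet [] = ∅
  toSet (x ∷ xs) = ⁅ x ⁆ ∪ toSet xs

  set3 : Fin n → Fin n → Fin n → Subset n
  set3 a b c = toSet (a ∷ b ∷ c ∷ [])

  set4 : Fin n → Fin n → Fin n → Fin n → Subset n
  set4 a b c d = toSet (a ∷ b ∷ c ∷ d ∷ [])

  FirstTriple : List (Fin n) → Set
  FirstTriple (a ∷ b ∷ c ∷ _) = Triangle (set3 a b c) ⊎ Triad (set3 a b c)
  FirstTriple _ = ⊥

  FirstIsTriangle : List (Fin n) → Set
  FirstIsTriangle (a ∷ b ∷ c ∷ _) = Triangle (set3 a b c)
  FirstIsTriangle _ = ⊥

  Alternating : List (Fin n) → Set
  Alternating (a ∷ b ∷ c ∷ d ∷ rest) =
    (Triangle (set3 a b c) → Triad (set3 b c d)) ×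
    (Triad (set3 a b c) → Triangle (set3 b c d)) ×
    Alternating (b ∷ c ∷ d ∷ rest)
  Alternating _ = ⊤

  FanOrdering : List (Fin n) → Set
  FanOrdering es = Unique es × 3 ≤ length es × FirstTriple es × Alternating es

  IsFan : Subset n → Set
  IsFan F = (∃[ es ] (FanOrdering es × toSet es ≡ F)) ⊎ ∣ F ∣ ≡ 2

  MaximalFan : Subset n → Set
  MaximalFan F = IsFan F × (∀ F' → IsFan F' → ¬ (F ⊂ F'))

  NotIn4Fan : Subset n → Set
  NotIn4Fan T = ∀ F' → IsFan F' → ∣ F' ∣ ≡ 4 → ¬ (T ⊆ F')

  EndBase : Subset n → Subset n → Set
  EndBase F X = X ⊆ ∁ F × ∣ X ∪ F ∣ + 2 ≤ n

  -- left-hand ends (e1, e2 are the first two elements of the ordering of F)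
  LeftFanEnd : Subset n → Fin n → Fin n → Subset n → Set
  LeftFanEnd F e1 e2 X = EndBase F X ×
    ∃[ g2 ] ∃[ g3 ] ∃[ g4 ] ∃[ g5 ]
      (X ≡ set4 g2 g3 g4 g5 ×
       FanOrdering (e1 ∷ g2 ∷ g3 ∷ g4 ∷ g5 ∷ []) ×
       MaximalFan (X ∪ ⁅ e1 ⁆) ×
       Triangle (set3 e1 g2 g3) ×
       Cocircuit (set4 e1 e2 g3 g5))

  LeftQuadEnd : Subset n → Fin n → Fin n → Subset n → Set
  LeftQuadEnd F e1 e2 X = EndBase F X ×
    ∃[ a1 ] ∃[ a2 ] ∃[ b1 ] ∃[ b2 ]
      (X ≡ set4 a1 a2 b1 b2 × Quad X ×
       Triangle (set3 e1 a1 a2) × NotIn4Fan (set3 e1 a1 a2) ×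
       Triangle (set3 e1 b1 b2) × NotIn4Fan (set3 e1 b1 b2) ×
       Cocircuit (set4 e1 e2 a1 b1) × Cocircuit (set4 e1 e2 a2 b2))

  LeftTriangleEnd : Subset n → Fin n → Fin n → Subset n → Set
  LeftTriangleEnd F e1 e2 X = EndBase F X ×
    Triangle (X ∪ ⁅ e1 ⁆) × NotIn4Fan (X ∪ ⁅ e1 ⁆) ×
    Cocircuit (X ∪ ⁅ e1 ⁆ ∪ ⁅ e2 ⁆)

  -- right-hand ends (f1 = e_{|F|-1}, f2 = e_{|F|})
  RightFanEnd : Subset n → Fin n → Fin n → Subset n → Set
  RightFanEnd F f1 f2 X = EndBase F X ×
    ∃[ h2 ] ∃[ h3 ] ∃[ h4 ] ∃[ h5 ]
      (X ≡ set4 h2 h3 h4 h5 ×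
       FanOrdering (f2 ∷ h2 ∷ h3 ∷ h4 ∷ h5 ∷ []) ×
       MaximalFan (X ∪ ⁅ f2 ⁆) ×
       Triad (set3 f2 h2 h3) ×
       Circuit (set4 f1 f2 h3 h5))

  RightQuadEnd : Subset n → Fin n → Fin n → Subset n → Set
  RightQuadEnd F f1 f2 X = EndBase F X ×
    ∃[ c1 ] ∃[ c2 ] ∃[ d1 ] ∃[ d2 ]
      (X ≡ set4 c1 c2 d1 d2 × Quad X ×
       Triad (set3 f2 c1 c2) × NotIn4Fan (set3 f2 c1 c2) ×
       Triad (set3 f2 d1 d2) × NotIn4Fan (set3 f2 d1 d2) ×
       Circuit (set4 f1 f2 c1 d1) × Circuit (set4 f1 f2 c2 d2))

  RightTriadEnd : Subset n → Fin n → Fin n → Subset n → Set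
  RightTriadEnd F f1 f2 X = EndBase F X ×
    Triad (X ∪ ⁅ f2 ⁆) × NotIn4Fan (X ∪ ⁅ f2 ⁆) ×
    Circuit (X ∪ ⁅ f1 ⁆ ∪ ⁅ f2 ⁆)

  Partition3 : Subset n → Subset n → Subset n → Set
  Partition3 G F H = G ∩ F ≡ ∅ × G ∩ H ≡ ∅ × F ∩ H ≡ ∅ × G ∪ F ∪ H ≡ Full

  Accordion : Subset n → List (Fin n) → Subset n → Set
  Accordion G es H =
    Partition3 G (toSet es) H ×
    FanOrdering es × FirstIsTriangle es × MaximalFan (toSet es) ×
    2 ∣ length es × 4 ≤ length es ×
    (∃[ e1 ] ∃[ e2 ] ∃[ rest ] (es ≡ e1 ∷ e2 ∷ rest ×
       (LeftFanEnd (toSet es) e1 e2 G ⊎ LeftQuadEnd (toSet es) e1 e2 G ⊎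
        LeftTriangleEnd (toSet es) e1 e2 G))) ×
    (∃[ init ] ∃[ f1 ] ∃[ f2 ] (es ≡ init ++ f1 ∷ f2 ∷ [] ×
       (RightFanEnd (toSet es) f1 f2 H ⊎ RightQuadEnd (toSet es) f1 f2 H ⊎
        RightTriadEnd (toSet es) f1 f2 H)))

{-# OPTIONS --safe #-}
-- Every element of the fan F after e₁, e₂ lies in the closure or the coclosure
-- of its predecessors, so λ(F) ≤ 2, i.e. r(F) + r(G ∪ H) ≤ r(E) + 2. The
-- triangle G ∪ e₁ gives r(G) = 2 and r(E − H) = r(G ∪ F) ≤ r(F) + 1, and the
-- cocircuit G ∪ {e₁, e₂} gives r(H) < r(G ∪ H). Against the 3-connectivity
-- bounds λ(G), λ(H) ≥ 2 this forces r(G ∪ H) = r(H) + 1, r(E − H) = r(F) + 1 and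
-- r(E − G) = r(E). Hence ⊓(G, H) = 1, and since G is coindependent and disjoint
-- from H, ⊓*(G, H) = r(E − H) − r(E − (G ∪ H)) = r(E − H) − r(F) = 1.
module Submission where

open import Defs
open import Data.Nat using (ℕ; suc; _+_; _∸_; _≤_; _<_; z≤n; s≤s; >-nonZero)
open import Data.Nat.Properties
open import Data.Fin using (Fin)
open import Data.Fin.Subset
  using (Subset; inside; outside; ⁅_⁆; _∈_; _∉_; _⊆_; _⊂_; ∁; _∩_; _∪_; _-_; ∣_∣; Nonempty)
  renaming (⊥ to ∅; ⊤ to Full)
open import Data.Fin.Subset.Properties
open import Data.Vec using ([]; _∷_)
open import Data.List using (List; []; _∷_)
open import Data.Product using (_×_; _,_; proj₁; proj₂)
open import Data.Sum using (_⊎_; inj₁; inj₂; [_,_]′)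
open import Function using (_∘_)
open import Relation.Nullary using (yes; no; contradiction)
open import Relation.Binary.PropositionalEquality
  using (_≡_; refl; sym; trans; cong; cong₂; subst; subst₂; module ≡-Reasoning)

∣p∪q∣+∣p∩q∣≡∣p∣+∣q∣ : ∀ {n} (p q : Subset n) → ∣ p ∪ q ∣ + ∣ p ∩ q ∣ ≡ ∣ p ∣ + ∣ q ∣
∣p∪q∣+∣p∩q∣≡∣p∣+∣q∣ []            []            = refl
∣p∪q∣+∣p∩q∣≡∣p∣+∣q∣ (inside ∷ p)  (inside ∷ q)  = cong suc (begin
  ∣ p ∪ q ∣ + suc ∣ p ∩ q ∣    ≡⟨ +-suc ∣ p ∪ q ∣ ∣ p ∩ q ∣ ⟩
  suc (∣ p ∪ q ∣ + ∣ p ∩ q ∣)  ≡⟨ cong suc (∣p∪q∣+∣p∩q∣≡∣p∣+∣q∣ p q) ⟩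
  suc (∣ p ∣ + ∣ q ∣)          ≡⟨ +-suc ∣ p ∣ ∣ q ∣ ⟨
  ∣ p ∣ + suc ∣ q ∣            ∎)
  where open ≡-Reasoning
∣p∪q∣+∣p∩q∣≡∣p∣+∣q∣ (inside ∷ p)  (outside ∷ q) = cong suc (∣p∪q∣+∣p∩q∣≡∣p∣+∣q∣ p q)
∣p∪q∣+∣p∩q∣≡∣p∣+∣q∣ (outside ∷ p) (inside ∷ q)  =
  trans (cong suc (∣p∪q∣+∣p∩q∣≡∣p∣+∣q∣ p q)) (sym (+-suc ∣ p ∣ ∣ q ∣))
∣p∪q∣+∣p∩q∣≡∣p∣+∣q∣ (outside ∷ p) (outside ∷ q) = ∣p∪q∣+∣p∩q∣≡∣p∣+∣q∣ p q

module _ {n : ℕ} where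

  ∣p∪q∣≤∣p∣+∣q∣ : ∀ (p q : Subset n) → ∣ p ∪ q ∣ ≤ ∣ p ∣ + ∣ q ∣
  ∣p∪q∣≤∣p∣+∣q∣ p q =
    subst (∣ p ∪ q ∣ ≤_) (∣p∪q∣+∣p∩q∣≡∣p∣+∣q∣ p q) (m≤m+n ∣ p ∪ q ∣ ∣ p ∩ q ∣)

  ∣p∪⁅x⁆∣≤1+∣p∣ : ∀ (p : Subset n) x → ∣ p ∪ ⁅ x ⁆ ∣ ≤ suc ∣ p ∣
  ∣p∪⁅x⁆∣≤1+∣p∣ p x = begin
    ∣ p ∪ ⁅ x ⁆ ∣      ≤⟨ ∣p∪q∣≤∣p∣+∣q∣ p ⁅ x ⁆ ⟩
    ∣ p ∣ + ∣ ⁅ x ⁆ ∣  ≡⟨ cong (∣ p ∣ +_) (∣⁅x⁆∣≡1 x) ⟩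
    ∣ p ∣ + 1          ≡⟨ +-comm ∣ p ∣ 1 ⟩
    suc ∣ p ∣          ∎
    where open ≤-Reasoning

  p∩q≡∅⇒∣p∪q∣≡∣p∣+∣q∣ : ∀ {p q : Subset n} → p ∩ q ≡ ∅ → ∣ p ∪ q ∣ ≡ ∣ p ∣ + ∣ q ∣
  p∩q≡∅⇒∣p∪q∣≡∣p∣+∣q∣ {p} {q} p∩q≡∅ = begin
    ∣ p ∪ q ∣                ≡⟨ +-identityʳ ∣ p ∪ q ∣ ⟨
    ∣ p ∪ q ∣ + 0            ≡⟨ cong (∣ p ∪ q ∣ +_) (trans (cong ∣_∣ p∩q≡∅) (∣⊥∣≡0 n)) ⟨
    ∣ p ∪ q ∣ + ∣ p ∩ q ∣    ≡⟨ ∣p∪q∣+∣p∩q∣≡∣p∣+∣q∣ p q ⟩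
    ∣ p ∣ + ∣ q ∣            ∎
    where open ≡-Reasoning

  p∩q≡∅⇒x∈p⇒x∉q : ∀ {p q : Subset n} {x} → p ∩ q ≡ ∅ → x ∈ p → x ∉ q
  p∩q≡∅⇒x∈p⇒x∉q {x = x} p∩q≡∅ x∈p x∈q = ∉⊥ (subst (x ∈_) p∩q≡∅ (x∈p∩q⁺ (x∈p , x∈q)))

  x∈p⇒⁅x⁆⊆p : ∀ {p : Subset n} {x} → x ∈ p → ⁅ x ⁆ ⊆ p
  x∈p⇒⁅x⁆⊆p {p} {x} x∈p y∈⁅x⁆ = subst (_∈ p) (sym (x∈⁅y⁆⇒x≡y x y∈⁅x⁆)) x∈p

  x∈p⇒p∪⁅x⁆≡p : ∀ {p : Subset n} {x} → x ∈ p → p ∪ ⁅ x ⁆ ≡ p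
  x∈p⇒p∪⁅x⁆≡p {p} {x} x∈p = ⊆-antisym p∪⁅x⁆⊆p (p⊆p∪q ⁅ x ⁆)
    where
    p∪⁅x⁆⊆p : p ∪ ⁅ x ⁆ ⊆ p
    p∪⁅x⁆⊆p y∈ = [ (λ y∈p → y∈p) , x∈p⇒⁅x⁆⊆p x∈p ]′ (x∈p∪q⁻ p ⁅ x ⁆ y∈)

  x∈p⇒0<∣p∣ : ∀ {p : Subset n} {x} → x ∈ p → 0 < ∣ p ∣
  x∈p⇒0<∣p∣ {x = x} x∈p = subst (_≤ _) (∣⁅x⁆∣≡1 x) (p⊆q⇒∣p∣≤∣q∣ (x∈p⇒⁅x⁆⊆p x∈p))

  0<∣p∣⇒nonempty : ∀ {p : Subset n} → 0 < ∣ p ∣ → Nonempty p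
  0<∣p∣⇒nonempty {p} 0<∣p∣ with nonempty? p
  ... | yes p≢∅ = p≢∅
  ... | no  p≡∅ = contradiction (trans (cong ∣_∣ (Empty-unique p≡∅)) (∣⊥∣≡0 n)) (>⇒≢ 0<∣p∣)

  ∁-unique : ∀ {p q : Subset n} → p ∩ q ≡ ∅ → p ∪ q ≡ Full → ∁ p ≡ q
  ∁-unique {p} {q} p∩q≡∅ p∪q≡Full = ⊆-antisym ∁p⊆q q⊆∁p
    where
    ∁p⊆q : ∁ p ⊆ q
    ∁p⊆q {x} x∈∁p with x∈p∪q⁻ p q (subst (x ∈_) (sym p∪q≡Full) ∈⊤)
    ... | inj₁ x∈p = contradiction x∈p (x∈∁p⇒x∉p x∈∁p)
    ... | inj₂ x∈q = x∈q
    q⊆∁p : q ⊆ ∁ p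
    q⊆∁p x∈q = x∉p⇒x∈∁p (λ x∈p → p∩q≡∅⇒x∈p⇒x∉q p∩q≡∅ x∈p x∈q)

module _ {n : ℕ} (M : Matroid n) where
  open Matroid M

  module _ {G F H : Subset n} (partition : Partition3 M G F H) where
    private
      G∩F≡∅ : G ∩ F ≡ ∅
      G∩F≡∅ = proj₁ partition

      G∩H≡∅ : G ∩ H ≡ ∅
      G∩H≡∅ = proj₁ (proj₂ partition)

      F∩H≡∅ : F ∩ H ≡ ∅
      F∩H≡∅ = proj₁ (proj₂ (proj₂ partition))

      G∪F∪H≡Full : G ∪ F ∪ H ≡ Full
      G∪F∪H≡Full = proj₂ (proj₂ (proj₂ partition))

      [G∪H]∩F≡∅ : (G ∪ H) ∩ F ≡ ∅
      [G∪H]∩F≡∅ = begin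
        (G ∪ H) ∩ F          ≡⟨ ∩-distribʳ-∪ F G H ⟩
        (G ∩ F) ∪ (H ∩ F)    ≡⟨ cong₂ _∪_ G∩F≡∅ (trans (∩-comm H F) F∩H≡∅) ⟩
        ∅ ∪ ∅                ≡⟨ ∪-identityʳ ∅ ⟩
        ∅                    ∎
        where open ≡-Reasoning

      [G∪H]∪F≡Full : (G ∪ H) ∪ F ≡ Full
      [G∪H]∪F≡Full = begin
        (G ∪ H) ∪ F    ≡⟨ ∪-assoc G H F ⟩
        G ∪ (H ∪ F)    ≡⟨ cong (G ∪_) (∪-comm H F) ⟩
        G ∪ F ∪ H      ≡⟨ G∪F∪H≡Full ⟩
        Full           ∎
        where open ≡-Reasoning

      [G∪F]∩H≡∅ : (G ∪ F) ∩ H ≡ ∅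
      [G∪F]∩H≡∅ = begin
        (G ∪ F) ∩ H          ≡⟨ ∩-distribʳ-∪ H G F ⟩
        (G ∩ H) ∪ (F ∩ H)    ≡⟨ cong₂ _∪_ G∩H≡∅ F∩H≡∅ ⟩
        ∅ ∪ ∅                ≡⟨ ∪-identityʳ ∅ ⟩
        ∅                    ∎
        where open ≡-Reasoning

    partition⇒∁[G∪H]≡F : ∁ (G ∪ H) ≡ F
    partition⇒∁[G∪H]≡F = ∁-unique [G∪H]∩F≡∅ [G∪H]∪F≡Full

    partition⇒∁F≡G∪H : ∁ F ≡ G ∪ H
    partition⇒∁F≡G∪H =
      ∁-unique (trans (∩-comm F (G ∪ H)) [G∪H]∩F≡∅) (trans (∪-comm F (G ∪ H)) [G∪H]∪F≡Full)

    partition⇒∁[G∪F]≡H : ∁ (G ∪ F) ≡ H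
    partition⇒∁[G∪F]≡H = ∁-unique [G∪F]∩H≡∅ (trans (∪-assoc G F H) G∪F∪H≡Full)

    partition⇒2≤∣H∣ : ∣ G ∪ F ∣ + 2 ≤ n → 2 ≤ ∣ H ∣
    partition⇒2≤∣H∣ ∣G∪F∣+2≤n = begin
      2                  ≤⟨ m+n≤o⇒m≤o∸n 2 (subst (_≤ n) (+-comm ∣ G ∪ F ∣ 2) ∣G∪F∣+2≤n) ⟩
      n ∸ ∣ G ∪ F ∣      ≡⟨ ∣∁p∣≡n∸∣p∣ (G ∪ F) ⟨
      ∣ ∁ (G ∪ F) ∣      ≡⟨ cong ∣_∣ partition⇒∁[G∪F]≡H ⟩
      ∣ H ∣              ∎
      where open ≤-Reasoning

  r-∪≤ : ∀ X Y → r (X ∪ Y) ≤ r X + r Y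
  r-∪≤ X Y = ≤-trans (m≤m+n (r (X ∪ Y)) (r (X ∩ Y))) (r-submod X Y)

  r⁅x⁆≤1 : ∀ x → r ⁅ x ⁆ ≤ 1
  r⁅x⁆≤1 x = ≤-trans (r-bound ⁅ x ⁆) (≤-reflexive (∣⁅x⁆∣≡1 x))

  r-∪⁅x⁆≤1+r : ∀ P x → r (P ∪ ⁅ x ⁆) ≤ suc (r P)
  r-∪⁅x⁆≤1+r P x = begin
    r (P ∪ ⁅ x ⁆)    ≤⟨ r-∪≤ P ⁅ x ⁆ ⟩
    r P + r ⁅ x ⁆    ≤⟨ +-monoʳ-≤ (r P) (r⁅x⁆≤1 x) ⟩
    r P + 1          ≡⟨ +-comm (r P) 1 ⟩
    suc (r P)        ∎
    where open ≤-Reasoning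

  circuit-⊂⇒independent : ∀ {C Y} → Circuit M C → Y ⊂ C → ∣ Y ∣ ≤ r Y
  circuit-⊂⇒independent (_ , minimal) Y⊂C = ≮⇒≥ (minimal _ Y⊂C)

  r-∪-circuit< : ∀ {C Y P} → Circuit M C → Y ⊂ C → Y ⊆ P → r (P ∪ C) + ∣ Y ∣ < r P + ∣ C ∣
  r-∪-circuit< {C} {Y} {P} circuit@(dependent , _) Y⊂C Y⊆P = begin-strict
    r (P ∪ C) + ∣ Y ∣        ≤⟨ +-monoʳ-≤ (r (P ∪ C)) (≤-trans (circuit-⊂⇒independent circuit Y⊂C)
                                                               (r-mono Y (P ∩ C) Y⊆P∩C)) ⟩
    r (P ∪ C) + r (P ∩ C)    ≤⟨ r-submod P C ⟩
    r P + r C                <⟨ +-monoʳ-< (r P) dependent ⟩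
    r P + ∣ C ∣              ∎
    where
    open ≤-Reasoning
    Y⊆P∩C : Y ⊆ P ∩ C
    Y⊆P∩C y∈Y = x∈p∩q⁺ (Y⊆P y∈Y , p⊂q⇒p⊆q Y⊂C y∈Y)

  circuit⇒r-∪⁅x⁆≤r : ∀ {C P x} → Circuit M C → x ∈ C → C ⊆ P ∪ ⁅ x ⁆ → r (P ∪ ⁅ x ⁆) ≤ r P
  circuit⇒r-∪⁅x⁆≤r {C} {P} {x} circuit x∈C C⊆P∪⁅x⁆ with x ∈? P
  ... | yes x∈P = ≤-reflexive (cong r (x∈p⇒p∪⁅x⁆≡p x∈P))
  ... | no  x∉P = +-cancelʳ-≤ ∣ P ∩ C ∣ _ _ (≤-pred (begin-strict
    r (P ∪ ⁅ x ⁆) + ∣ P ∩ C ∣    ≤⟨ +-monoˡ-≤ ∣ P ∩ C ∣ (r-mono _ _ P∪⁅x⁆⊆P∪C) ⟩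
    r (P ∪ C) + ∣ P ∩ C ∣        <⟨ r-∪-circuit< circuit P∩C⊂C (p∩q⊆p P C) ⟩
    r P + ∣ C ∣                  ≤⟨ +-monoʳ-≤ (r P) ∣C∣≤1+∣P∩C∣ ⟩
    r P + suc ∣ P ∩ C ∣          ≡⟨ +-suc (r P) ∣ P ∩ C ∣ ⟩
    suc (r P + ∣ P ∩ C ∣)        ∎))
    where
    open ≤-Reasoning
    P∩C⊂C : P ∩ C ⊂ C
    P∩C⊂C = p∩q⊆q P C , x , x∈C , x∉P ∘ proj₁ ∘ x∈p∩q⁻ P C
    P∪⁅x⁆⊆P∪C : P ∪ ⁅ x ⁆ ⊆ P ∪ C
    P∪⁅x⁆⊆P∪C y∈ = [ p⊆p∪q C , q⊆p∪q P C ∘ x∈p⇒⁅x⁆⊆p x∈C ]′ (x∈p∪q⁻ P ⁅ x ⁆ y∈)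
    C⊆[P∩C]∪⁅x⁆ : C ⊆ (P ∩ C) ∪ ⁅ x ⁆
    C⊆[P∩C]∪⁅x⁆ {y} y∈C = [ (λ y∈P → p⊆p∪q ⁅ x ⁆ (x∈p∩q⁺ (y∈P , y∈C))) , q⊆p∪q (P ∩ C) ⁅ x ⁆ ]′
                                (x∈p∪q⁻ P ⁅ x ⁆ (C⊆P∪⁅x⁆ y∈C))
    ∣C∣≤1+∣P∩C∣ : ∣ C ∣ ≤ suc ∣ P ∩ C ∣
    ∣C∣≤1+∣P∩C∣ = ≤-trans (p⊆q⇒∣p∣≤∣q∣ C⊆[P∩C]∪⁅x⁆) (∣p∪⁅x⁆∣≤1+∣p∣ (P ∩ C) x)

  cocircuit⇒r∁<rE : ∀ {C} → Cocircuit M C → r (∁ C) < r Full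
  cocircuit⇒r∁<rE {C} (codependent , _) = ≰⇒> λ rE≤r∁C → <⇒≱ codependent (begin
    ∣ C ∣                         ≤⟨ m≤m+n ∣ C ∣ _ ⟩
    ∣ C ∣ + (r (∁ C) ∸ r Full)    ≡⟨ +-∸-assoc ∣ C ∣ rE≤r∁C ⟨
    ∣ C ∣ + r (∁ C) ∸ r Full      ∎)
    where open ≤-Reasoning

  cocircuit-⊂⇒rE≤r∁ : ∀ {C Y} → Cocircuit M C → Y ⊂ C → r Full ≤ r (∁ Y)
  cocircuit-⊂⇒rE≤r∁ {Y = Y} (_ , minimal) Y⊂C with nonempty? Y
  ... | no  Y≡∅ = r-mono Full (∁ Y) (λ {x} _ → x∉p⇒x∈∁p (λ x∈Y → Y≡∅ (x , x∈Y)))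
  ... | yes (_ , y∈Y) = ≮⇒≥ λ r∁Y<rE → minimal Y Y⊂C
    (m<n+o⇒m∸n<o (∣ Y ∣ + r (∁ Y)) (r Full) {{>-nonZero (x∈p⇒0<∣p∣ y∈Y)}}
      (subst (∣ Y ∣ + r (∁ Y) <_) (+-comm ∣ Y ∣ (r Full)) (+-monoʳ-< ∣ Y ∣ r∁Y<rE)))

  cocircuit⇒r<r-∪⁅x⁆ : ∀ {C Q x} → Cocircuit M C → x ∈ C → Q ⊆ ∁ C → r Q < r (Q ∪ ⁅ x ⁆)
  cocircuit⇒r<r-∪⁅x⁆ {C} {Q} {x} cocircuit x∈C Q⊆∁C = +-cancelˡ-< (r Full) _ _ (begin-strict
    r Full + r Q                ≤⟨ +-mono-≤ (≤-trans (cocircuit-⊂⇒rE≤r∁ cocircuit (x∈p⇒p-x⊂p x∈C))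
                                                     (r-mono _ _ ∁[C-x]⊆∁C∪A))
                                            (r-mono _ _ Q⊆∁C∩A) ⟩
    r (∁ C ∪ A) + r (∁ C ∩ A)   ≤⟨ r-submod (∁ C) A ⟩
    r (∁ C) + r A               <⟨ +-monoˡ-< (r A) (cocircuit⇒r∁<rE cocircuit) ⟩
    r Full + r A                ∎)
    where
    open ≤-Reasoning
    A : Subset n
    A = Q ∪ ⁅ x ⁆
    Q⊆∁C∩A : Q ⊆ ∁ C ∩ A
    Q⊆∁C∩A y∈Q = x∈p∩q⁺ (Q⊆∁C y∈Q , p⊆p∪q ⁅ x ⁆ y∈Q)
    ∁[C-x]⊆∁C∪A : ∁ (C - x) ⊆ ∁ C ∪ A
    ∁[C-x]⊆∁C∪A {y} y∈∁[C-x] with y ∈? C | y ∈? ⁅ x ⁆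
    ... | no  y∉C | _        = p⊆p∪q A (x∉p⇒x∈∁p y∉C)
    ... | yes _   | yes y∈⁅x⁆ = q⊆p∪q (∁ C) A (q⊆p∪q Q ⁅ x ⁆ y∈⁅x⁆)
    ... | yes y∈C | no  y∉⁅x⁆ =
      contradiction (x∈p∧x∉q⇒x∈p─q y∈C y∉⁅x⁆) (x∈∁p⇒x∉p y∈∁[C-x])

  -- conn X = λ⁺ X ∸ r Full; stating bounds on λ⁺ avoids truncated subtraction.
  λ⁺ : Subset n → ℕ
  λ⁺ X = r X + r (∁ X)

  λ⁺-∪-circuit-element : ∀ {C P x} → Circuit M C → x ∈ C → C ⊆ P ∪ ⁅ x ⁆ →
                         λ⁺ (P ∪ ⁅ x ⁆) ≤ λ⁺ P
  λ⁺-∪-circuit-element {x = x} circuit x∈C C⊆P∪⁅x⁆ =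
    +-mono-≤ (circuit⇒r-∪⁅x⁆≤r circuit x∈C C⊆P∪⁅x⁆) (r-mono _ _ (p⊆q⇒∁p⊇∁q (p⊆p∪q ⁅ x ⁆)))

  λ⁺-∪-cocircuit-element : ∀ {C P x} → Cocircuit M C → x ∈ C → C ⊆ P ∪ ⁅ x ⁆ →
                           λ⁺ (P ∪ ⁅ x ⁆) ≤ λ⁺ P
  λ⁺-∪-cocircuit-element {P = P} {x} cocircuit x∈C C⊆P∪⁅x⁆ with x ∈? P
  ... | yes x∈P = ≤-reflexive (cong λ⁺ (x∈p⇒p∪⁅x⁆≡p x∈P))
  ... | no  x∉P = begin
    r (P ∪ ⁅ x ⁆) + r Q      ≤⟨ +-monoˡ-≤ (r Q) (r-∪⁅x⁆≤1+r P x) ⟩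
    suc (r P) + r Q          ≡⟨ +-suc (r P) (r Q) ⟨
    r P + suc (r Q)          ≤⟨ +-monoʳ-≤ (r P) (≤-trans r<r-∪⁅x⁆ (r-mono _ _ Q∪⁅x⁆⊆∁P)) ⟩
    r P + r (∁ P)            ∎
    where
    open ≤-Reasoning
    Q : Subset n
    Q = ∁ (P ∪ ⁅ x ⁆)
    r<r-∪⁅x⁆ : r Q < r (Q ∪ ⁅ x ⁆)
    r<r-∪⁅x⁆ = cocircuit⇒r<r-∪⁅x⁆ cocircuit x∈C (p⊆q⇒∁p⊇∁q C⊆P∪⁅x⁆)
    Q∪⁅x⁆⊆∁P : Q ∪ ⁅ x ⁆ ⊆ ∁ P
    Q∪⁅x⁆⊆∁P y∈ = [ p⊆q⇒∁p⊇∁q (p⊆p∪q ⁅ x ⁆) , x∈p⇒⁅x⁆⊆p (x∉p⇒x∈∁p x∉P) ]′ (x∈p∪q⁻ Q ⁅ x ⁆ y∈)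

  c∈set3 : ∀ a b c → c ∈ set3 M a b c
  c∈set3 a b c = x∈p∪q⁺ (inj₂ (x∈p∪q⁺ (inj₂ (x∈p∪q⁺ (inj₁ (x∈⁅x⁆ c))))))

  set3⊆P∪⁅c⁆ : ∀ {P a b c} → a ∈ P → b ∈ P → set3 M a b c ⊆ P ∪ ⁅ c ⁆
  set3⊆P∪⁅c⁆ {P} {a} {b} {c} a∈P b∈P y∈ with x∈p∪q⁻ ⁅ a ⁆ _ y∈
  ... | inj₁ y∈⁅a⁆ = p⊆p∪q ⁅ c ⁆ (x∈p⇒⁅x⁆⊆p a∈P y∈⁅a⁆)
  ... | inj₂ y∈bc with x∈p∪q⁻ ⁅ b ⁆ _ y∈bc
  ...   | inj₁ y∈⁅b⁆ = p⊆p∪q ⁅ c ⁆ (x∈p⇒⁅x⁆⊆p b∈P y∈⁅b⁆)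
  ...   | inj₂ y∈c∅ = q⊆p∪q P ⁅ c ⁆ (subst (_ ∈_) (∪-identityʳ ⁅ c ⁆) y∈c∅)

  λ⁺-∪-triple : ∀ {P a b c} → Triangle M (set3 M a b c) ⊎ Triad M (set3 M a b c) →
                a ∈ P → b ∈ P → λ⁺ (P ∪ ⁅ c ⁆) ≤ λ⁺ P
  λ⁺-∪-triple {a = a} {b} {c} (inj₁ (circuit , _)) a∈P b∈P =
    λ⁺-∪-circuit-element circuit (c∈set3 a b c) (set3⊆P∪⁅c⁆ a∈P b∈P)
  λ⁺-∪-triple {a = a} {b} {c} (inj₂ (cocircuit , _)) a∈P b∈P =
    λ⁺-∪-cocircuit-element cocircuit (c∈set3 a b c) (set3⊆P∪⁅c⁆ a∈P b∈P)

  λ⁺-∪-fan-tail : ∀ {P a b} ℓ → a ∈ P → b ∈ P →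
                  FirstTriple M (a ∷ b ∷ ℓ) → Alternating M (a ∷ b ∷ ℓ) → λ⁺ (P ∪ toSet M ℓ) ≤ λ⁺ P
  λ⁺-∪-fan-tail {P} (c ∷ []) a∈P b∈P abc _ = begin
    λ⁺ (P ∪ (⁅ c ⁆ ∪ ∅))   ≡⟨ cong (λ X → λ⁺ (P ∪ X)) (∪-identityʳ ⁅ c ⁆) ⟩
    λ⁺ (P ∪ ⁅ c ⁆)         ≤⟨ λ⁺-∪-triple abc a∈P b∈P ⟩
    λ⁺ P                   ∎
    where open ≤-Reasoning
  λ⁺-∪-fan-tail {P} {b = b} (c ∷ ℓ@(_ ∷ _)) a∈P b∈P abc
                (triangle⇒triad , triad⇒triangle , alternating) = begin
    λ⁺ (P ∪ (⁅ c ⁆ ∪ toSet M ℓ))   ≡⟨ cong λ⁺ (∪-assoc P ⁅ c ⁆ (toSet M ℓ)) ⟨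
    λ⁺ ((P ∪ ⁅ c ⁆) ∪ toSet M ℓ)   ≤⟨ λ⁺-∪-fan-tail ℓ (p⊆p∪q ⁅ c ⁆ b∈P) (q⊆p∪q P ⁅ c ⁆ (x∈⁅x⁆ c))
                                                      bcd alternating ⟩
    λ⁺ (P ∪ ⁅ c ⁆)                 ≤⟨ λ⁺-∪-triple abc a∈P b∈P ⟩
    λ⁺ P                           ∎
    where
    open ≤-Reasoning
    bcd : FirstTriple M (b ∷ c ∷ ℓ)
    bcd = [ inj₂ ∘ triangle⇒triad , inj₁ ∘ triad⇒triangle ]′ abc

  fan⇒λ⁺≤2+rE : ∀ {es} → FanOrdering M es → λ⁺ (toSet M es) ≤ 2 + r Full
  fan⇒λ⁺≤2+rE {a ∷ b ∷ ℓ} (_ , _ , abc , alternating) = begin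
    λ⁺ (⁅ a ⁆ ∪ (⁅ b ⁆ ∪ toSet M ℓ))    ≡⟨ cong λ⁺ (∪-assoc ⁅ a ⁆ ⁅ b ⁆ (toSet M ℓ)) ⟨
    λ⁺ ((⁅ a ⁆ ∪ ⁅ b ⁆) ∪ toSet M ℓ)    ≤⟨ λ⁺-∪-fan-tail ℓ (p⊆p∪q ⁅ b ⁆ (x∈⁅x⁆ a))
                                                         (q⊆p∪q ⁅ a ⁆ ⁅ b ⁆ (x∈⁅x⁆ b)) abc alternating ⟩
    r (⁅ a ⁆ ∪ ⁅ b ⁆) + r (∁ (⁅ a ⁆ ∪ ⁅ b ⁆))
                                         ≤⟨ +-mono-≤ r-pair≤2 (r-mono _ Full ⊆⊤) ⟩
    2 + r Full                           ∎
    where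
    open ≤-Reasoning
    r-pair≤2 : r (⁅ a ⁆ ∪ ⁅ b ⁆) ≤ 2
    r-pair≤2 = ≤-trans (r-∪⁅x⁆≤1+r ⁅ a ⁆ b) (s≤s (r⁅x⁆≤1 a))

  3-connected⇒2+rE≤λ⁺ : ThreeConnected M → ∀ {X} → 2 ≤ ∣ X ∣ → 2 ≤ ∣ ∁ X ∣ → 2 + r Full ≤ λ⁺ X
  3-connected⇒2+rE≤λ⁺ three-connected {X} 2≤∣X∣ 2≤∣∁X∣ =
    m≤o∸n⇒m+n≤o 2 (<⇒≤ (m∸n≢0⇒n<m (>⇒≢ (≤-trans (s≤s z≤n) 2≤conn)))) 2≤conn
    where
    2≤conn : 2 ≤ conn M X
    2≤conn = three-connected 2 X (s≤s z≤n) ≤-refl 2≤∣X∣ 2≤∣∁X∣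

  ⊓*-coindependent : ∀ {X Y} → X ∩ Y ≡ ∅ → r (∁ X) ≡ r Full →
                     ⊓* M X Y + r (∁ (X ∪ Y)) ≡ r (∁ Y)
  ⊓*-coindependent {X} {Y} X∩Y≡∅ r∁X≡rE = trans (cong (_+ u) ⊓*≡d) (m∸n+n≡m u≤v)
    where
    u v d k : ℕ
    u = r (∁ (X ∪ Y))
    v = r (∁ Y)
    d = v ∸ u
    k = ∣ Y ∣ + u ∸ r Full
    u≤v : u ≤ v
    u≤v = r-mono _ _ (p⊆q⇒∁p⊇∁q (q⊆p∪q X Y))
    ∁X⊆Y∪∁[X∪Y] : ∁ X ⊆ Y ∪ ∁ (X ∪ Y)
    ∁X⊆Y∪∁[X∪Y] {y} y∈∁X with y ∈? Y
    ... | yes y∈Y = p⊆p∪q _ y∈Y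
    ... | no  y∉Y = q⊆p∪q Y _ (x∉p⇒x∈∁p ([ x∈∁p⇒x∉p y∈∁X , y∉Y ]′ ∘ x∈p∪q⁻ X Y))
    rE≤∣Y∣+u : r Full ≤ ∣ Y ∣ + u
    rE≤∣Y∣+u = begin
      r Full              ≡⟨ r∁X≡rE ⟨
      r (∁ X)             ≤⟨ r-mono _ _ ∁X⊆Y∪∁[X∪Y] ⟩
      r (Y ∪ ∁ (X ∪ Y))   ≤⟨ r-∪≤ Y _ ⟩
      r Y + u             ≤⟨ +-monoˡ-≤ u (r-bound Y) ⟩
      ∣ Y ∣ + u           ∎
      where open ≤-Reasoning
    r*X≡∣X∣ : r* M X ≡ ∣ X ∣
    r*X≡∣X∣ = trans (cong (λ t → ∣ X ∣ + t ∸ r Full) r∁X≡rE) (m+n∸n≡m ∣ X ∣ (r Full))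
    r*Y≡k+d : r* M Y ≡ k + d
    r*Y≡k+d = begin
      ∣ Y ∣ + v ∸ r Full          ≡⟨ cong (λ t → ∣ Y ∣ + t ∸ r Full) (m+[n∸m]≡n u≤v) ⟨
      ∣ Y ∣ + (u + d) ∸ r Full    ≡⟨ cong (_∸ r Full) (+-assoc ∣ Y ∣ u d) ⟨
      ∣ Y ∣ + u + d ∸ r Full      ≡⟨ +-∸-comm d rE≤∣Y∣+u ⟩
      k + d                       ∎
      where open ≡-Reasoning
    r*[X∪Y]≡∣X∣+k : r* M (X ∪ Y) ≡ ∣ X ∣ + k
    r*[X∪Y]≡∣X∣+k = begin
      ∣ X ∪ Y ∣ + u ∸ r Full          ≡⟨ cong (λ t → t + u ∸ r Full) (p∩q≡∅⇒∣p∪q∣≡∣p∣+∣q∣ X∩Y≡∅) ⟩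
      ∣ X ∣ + ∣ Y ∣ + u ∸ r Full      ≡⟨ cong (_∸ r Full) (+-assoc ∣ X ∣ ∣ Y ∣ u) ⟩
      ∣ X ∣ + (∣ Y ∣ + u) ∸ r Full    ≡⟨ +-∸-assoc ∣ X ∣ rE≤∣Y∣+u ⟩
      ∣ X ∣ + k                       ∎
      where open ≡-Reasoning
    ⊓*≡d : ⊓* M X Y ≡ d
    ⊓*≡d = begin
      r* M X + r* M Y ∸ r* M (X ∪ Y)   ≡⟨ cong₂ _∸_ (cong₂ _+_ r*X≡∣X∣ r*Y≡k+d) r*[X∪Y]≡∣X∣+k ⟩
      ∣ X ∣ + (k + d) ∸ (∣ X ∣ + k)    ≡⟨ cong (_∸ (∣ X ∣ + k)) (+-assoc ∣ X ∣ k d) ⟨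
      ∣ X ∣ + k + d ∸ (∣ X ∣ + k)      ≡⟨ m+n∸m≡n (∣ X ∣ + k) d ⟩
      d                                ∎
      where open ≡-Reasoning

module TriangleEnd {n : ℕ} (M : Matroid n) (three-connected : ThreeConnected M)
  {G F H : Subset n} (partition : Partition3 M G F H)
  (F-3-separating : λ⁺ M F ≤ 2 + Matroid.r M Full) (2≤∣H∣ : 2 ≤ ∣ H ∣)
  {e₁ e₂ : Fin n} (e₁∈F : e₁ ∈ F) (e₂∈F : e₂ ∈ F)
  (triangle : Triangle M (G ∪ ⁅ e₁ ⁆)) (cocircuit : Cocircuit M (G ∪ ⁅ e₁ ⁆ ∪ ⁅ e₂ ⁆))
  where
  open Matroid M

  T : Subset n
  T = G ∪ ⁅ e₁ ⁆

  G∩H≡∅ : G ∩ H ≡ ∅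
  G∩H≡∅ = proj₁ (proj₂ partition)

  F-disjoint-G∪H : ∀ {x} → x ∈ F → x ∉ G ∪ H
  F-disjoint-G∪H {x} x∈F x∈G∪H =
    x∈∁p⇒x∉p (subst (x ∈_) (sym (partition⇒∁F≡G∪H M partition)) x∈G∪H) x∈F

  e₁∉G : e₁ ∉ G
  e₁∉G = F-disjoint-G∪H e₁∈F ∘ p⊆p∪q H

  G⊂T : G ⊂ T
  G⊂T = p⊆p∪q ⁅ e₁ ⁆ , e₁ , q⊆p∪q G ⁅ e₁ ⁆ (x∈⁅x⁆ e₁) , e₁∉G

  2≤∣G∣ : 2 ≤ ∣ G ∣
  2≤∣G∣ = ≤-pred (subst (_≤ suc ∣ G ∣) (proj₂ triangle) (∣p∪⁅x⁆∣≤1+∣p∣ G e₁))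

  G-nonempty : Nonempty G
  G-nonempty = 0<∣p∣⇒nonempty (≤-trans (s≤s z≤n) 2≤∣G∣)

  g : Fin n
  g = proj₁ G-nonempty

  g∈G : g ∈ G
  g∈G = proj₂ G-nonempty

  rG≡2 : r G ≡ 2
  rG≡2 = ≤-antisym rG≤2 (≤-trans 2≤∣G∣ (circuit-⊂⇒independent M (proj₁ triangle) G⊂T))
    where
    rG≤2 : r G ≤ 2
    rG≤2 = ≤-pred (≤-trans (s≤s (r-mono G T (p⊆p∪q ⁅ e₁ ⁆)))
                           (subst (r T <_) (proj₂ triangle) (proj₁ (proj₁ triangle))))

  r∁H≤1+rF : r (∁ H) ≤ suc (r F)
  r∁H≤1+rF = ≤-trans (r-mono _ _ ∁H⊆F∪T) (≤-pred (≤-pred 2+r[F∪T]≤3+rF))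
    where
    ⁅e₁⁆⊂T : ⁅ e₁ ⁆ ⊂ T
    ⁅e₁⁆⊂T = q⊆p∪q G ⁅ e₁ ⁆ , g , p⊆p∪q ⁅ e₁ ⁆ g∈G ,
             λ g∈⁅e₁⁆ → e₁∉G (subst (_∈ G) (x∈⁅y⁆⇒x≡y e₁ g∈⁅e₁⁆) g∈G)
    2+r[F∪T]≤3+rF : 2 + r (F ∪ T) ≤ 3 + r F
    2+r[F∪T]≤3+rF = subst₂ _≤_
      (cong suc (trans (cong (r (F ∪ T) +_) (∣⁅x⁆∣≡1 e₁)) (+-comm (r (F ∪ T)) 1)))
      (trans (cong (r F +_) (proj₂ triangle)) (+-comm (r F) 3))
      (r-∪-circuit< M (proj₁ triangle) ⁅e₁⁆⊂T (x∈p⇒⁅x⁆⊆p e₁∈F))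
    ∁H⊆F∪T : ∁ H ⊆ F ∪ T
    ∁H⊆F∪T {y} y∈∁H with y ∈? G
    ... | yes y∈G = q⊆p∪q F T (p⊆p∪q ⁅ e₁ ⁆ y∈G)
    ... | no  y∉G = p⊆p∪q T (subst (y ∈_) (partition⇒∁[G∪H]≡F M partition)
                                    (x∉p⇒x∈∁p ([ y∉G , x∈∁p⇒x∉p y∈∁H ]′ ∘ x∈p∪q⁻ G H)))

  rH<r[G∪H] : r H < r (G ∪ H)
  rH<r[G∪H] = ≤-trans (cocircuit⇒r<r-∪⁅x⁆ M cocircuit (p⊆p∪q _ g∈G) H⊆∁C) (r-mono _ _ H∪⁅g⁆⊆G∪H)
    where
    F-disjoint-H : ∀ {x y} → x ∈ F → y ∈ ⁅ x ⁆ → y ∉ H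
    F-disjoint-H {x} x∈F y∈⁅x⁆ y∈H =
      F-disjoint-G∪H x∈F (q⊆p∪q G H (subst (_∈ H) (x∈⁅y⁆⇒x≡y x y∈⁅x⁆) y∈H))
    H⊆∁C : H ⊆ ∁ (G ∪ ⁅ e₁ ⁆ ∪ ⁅ e₂ ⁆)
    H⊆∁C {y} y∈H = x∉p⇒x∈∁p λ y∈C → C-disjoint-H (x∈p∪q⁻ G _ y∈C) y∈H
      where
      C-disjoint-H : y ∈ G ⊎ y ∈ ⁅ e₁ ⁆ ∪ ⁅ e₂ ⁆ → y ∉ H
      C-disjoint-H (inj₁ y∈G)    = p∩q≡∅⇒x∈p⇒x∉q G∩H≡∅ y∈G
      C-disjoint-H (inj₂ y∈e₁e₂) =
        [ F-disjoint-H e₁∈F , F-disjoint-H e₂∈F ]′ (x∈p∪q⁻ ⁅ e₁ ⁆ ⁅ e₂ ⁆ y∈e₁e₂)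
    H∪⁅g⁆⊆G∪H : H ∪ ⁅ g ⁆ ⊆ G ∪ H
    H∪⁅g⁆⊆G∪H = [ q⊆p∪q G H , p⊆p∪q H ∘ x∈p⇒⁅x⁆⊆p g∈G ]′ ∘ x∈p∪q⁻ H ⁅ g ⁆

  F-bound : r F + r (G ∪ H) ≤ 2 + r Full
  F-bound = subst (λ X → r F + r X ≤ 2 + r Full) (partition⇒∁F≡G∪H M partition) F-3-separating

  H-bound : 2 + r Full ≤ r H + r (∁ H)
  H-bound = 3-connected⇒2+rE≤λ⁺ M three-connected 2≤∣H∣ (≤-trans 2≤∣G∣ (p⊆q⇒∣p∣≤∣q∣ G⊆∁H))
    where
    G⊆∁H : G ⊆ ∁ H
    G⊆∁H = x∉p⇒x∈∁p ∘ p∩q≡∅⇒x∈p⇒x∉q G∩H≡∅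

  G-bound : 2 + r Full ≤ r G + r (∁ G)
  G-bound = 3-connected⇒2+rE≤λ⁺ M three-connected 2≤∣G∣ (≤-trans 2≤∣H∣ (p⊆q⇒∣p∣≤∣q∣ H⊆∁G))
    where
    H⊆∁G : H ⊆ ∁ G
    H⊆∁G y∈H = x∉p⇒x∈∁p (λ y∈G → p∩q≡∅⇒x∈p⇒x∉q G∩H≡∅ y∈G y∈H)

  rH+1+rF≡rF+1+rH : r H + suc (r F) ≡ r F + suc (r H)
  rH+1+rF≡rF+1+rH = begin
    r H + suc (r F)     ≡⟨ +-suc (r H) (r F) ⟩
    suc (r H + r F)     ≡⟨ cong suc (+-comm (r H) (r F)) ⟩
    suc (r F + r H)     ≡⟨ +-suc (r F) (r H) ⟨
    r F + suc (r H)     ∎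
    where open ≡-Reasoning

  r[G∪H]≡1+rH : r (G ∪ H) ≡ suc (r H)
  r[G∪H]≡1+rH = ≤-antisym (+-cancelˡ-≤ (r F) _ _ (begin
    r F + r (G ∪ H)     ≤⟨ F-bound ⟩
    2 + r Full          ≤⟨ H-bound ⟩
    r H + r (∁ H)       ≤⟨ +-monoʳ-≤ (r H) r∁H≤1+rF ⟩
    r H + suc (r F)     ≡⟨ rH+1+rF≡rF+1+rH ⟩
    r F + suc (r H)     ∎)) rH<r[G∪H]
    where open ≤-Reasoning

  r∁H≡1+rF : r (∁ H) ≡ suc (r F)
  r∁H≡1+rF = ≤-antisym r∁H≤1+rF (+-cancelˡ-≤ (r H) _ _ (begin
    r H + suc (r F)     ≡⟨ rH+1+rF≡rF+1+rH ⟩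
    r F + suc (r H)     ≤⟨ +-monoʳ-≤ (r F) rH<r[G∪H] ⟩
    r F + r (G ∪ H)     ≤⟨ F-bound ⟩
    2 + r Full          ≤⟨ H-bound ⟩
    r H + r (∁ H)       ∎))
    where open ≤-Reasoning

  r∁G≡rE : r (∁ G) ≡ r Full
  r∁G≡rE = ≤-antisym (r-mono _ Full ⊆⊤)
    (+-cancelˡ-≤ 2 _ _ (subst (λ t → 2 + r Full ≤ t + r (∁ G)) rG≡2 G-bound))

  ⊓≡1 : ⊓ M G H ≡ 1
  ⊓≡1 = begin
    r G + r H ∸ r (G ∪ H)    ≡⟨ cong₂ (λ a c → a + r H ∸ c) rG≡2 r[G∪H]≡1+rH ⟩
    2 + r H ∸ suc (r H)      ≡⟨ m+n∸n≡m 1 (r H) ⟩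
    1                        ∎
    where open ≡-Reasoning

  ⊓*≡1 : ⊓* M G H ≡ 1
  ⊓*≡1 = +-cancelʳ-≡ (r F) _ _ (begin
    ⊓* M G H + r F             ≡⟨ cong (λ X → ⊓* M G H + r X) (partition⇒∁[G∪H]≡F M partition) ⟨
    ⊓* M G H + r (∁ (G ∪ H))   ≡⟨ ⊓*-coindependent M G∩H≡∅ r∁G≡rE ⟩
    r (∁ H)                    ≡⟨ r∁H≡1+rF ⟩
    suc (r F)                  ∎)
    where open ≡-Reasoning

lemma2p2 : ∀ {n : ℕ} (M : Matroid n) → ThreeConnected M →
    ∀ (G H : Subset n) (e1 e2 e3 : Fin n) (rest : List (Fin n)) →
    Accordion M G (e1 ∷ e2 ∷ e3 ∷ rest) H →
    LeftTriangleEnd M (toSet M (e1 ∷ e2 ∷ e3 ∷ rest)) e1 e2 G →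
    ⊓ M G H ≡ 1 × ⊓* M G H ≡ 1
lemma2p2 M three-connected G H e1 e2 e3 rest
  (partition , fan , _) ((_ , ∣G∪F∣+2≤n) , triangle , _ , cocircuit) = End.⊓≡1 , End.⊓*≡1
  where
  e1∈F : e1 ∈ toSet M (e1 ∷ e2 ∷ e3 ∷ rest)
  e1∈F = x∈p∪q⁺ (inj₁ (x∈⁅x⁆ e1))
  e2∈F : e2 ∈ toSet M (e1 ∷ e2 ∷ e3 ∷ rest)
  e2∈F = x∈p∪q⁺ (inj₂ (x∈p∪q⁺ (inj₁ (x∈⁅x⁆ e2))))
  module End = TriangleEnd M three-connected partition (fan⇒λ⁺≤2+rE M fan)
                 (partition⇒2≤∣H∣ M partition ∣G∪F∣+2≤n) e1∈F e2∈F triangle cocircuit
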